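{- Let $s$ be a positive integer and $C_s(x,y,z)=s(x^2+y^2+z^2)-s^3-2xyz$. Let $(v_1,v_2,v_3)$ be a solution of $C_s(v_1,v_2,v_3)=0$ in positive integers, and suppose that it can be reduced by the quadratic formula to a solution $(s,b,b)$ (up to permutation of coordinates) for some positive integer $b$, i.e. there is a finite sequence of moves transforming $(v_1,v_2,v_3)$ into a permutation of $(s,b,b)$, where a move replaces one coordinate of a solution by the other root of $C_s$ regarded as a quadratic in that coordinate with the other two coordinates fixed (e.g. $(w_1,w_2,w_3)\mapsto(2w_2w_3/s-w_1,w_2,w_3)$). Assume also that $s$ divides $2b$. Then there exist non-negative integers $n$ and $m$ such that \[ \{v_1,v_2,v_3\}=\{R_n(b),R_{n+m}(b),R_m(b)\}. \]
   Context: $R_n(b)$ is defined by $R_0(b)=s$, $R_1(b)=b$, $R_{n+1}(b)=\frac{2b}{s}R_n(b)-R_{n-1}(b)$; equivalently $R_n(b)=sT_n(b/s)$ with $T_n$ the Chebyshev polynomials of the first kind. -}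

module Defs where

open import Data.Nat as ℕ using (ℕ; zero; suc; NonZero)
open import Data.Integer as ℤ using (ℤ; +_)
open import Data.Rational as ℚ using (ℚ)
open import Data.Product using (_×_; _,_)
open import Data.Sum using (_⊎_)
open import Relation.Binary.PropositionalEquality using (_≡_)
open import Relation.Binary.Construct.Closure.ReflexiveTransitive using (Star)

Triple : Set
Triple = ℤ × ℤ × ℤ

C : ℕ → ℤ → ℤ → ℤ → ℤ
C s x y z = (+ s) ℤ.* (x ℤ.* x ℤ.+ y ℤ.* y ℤ.+ z ℤ.* z)
            ℤ.- (+ s) ℤ.* (+ s) ℤ.* (+ s) ℤ.- (+ 2) ℤ.* x ℤ.* y ℤ.* z

-- one move (Vieta jump): a coordinate w of a solution is replaced by the other
-- root w' of C_s as a quadratic in that coordinate, i.e. w' = 2 u v / s - w,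
-- written without division as s (w + w') = 2 u v.
data Move (s : ℕ) : Triple → Triple → Set where
  move₁ : ∀ {w₁ w₂ w₃ w₁'} → C s w₁ w₂ w₃ ≡ + 0 →
          (+ s) ℤ.* (w₁ ℤ.+ w₁') ≡ (+ 2) ℤ.* w₂ ℤ.* w₃ →
          Move s (w₁ , w₂ , w₃) (w₁' , w₂ , w₃)
  move₂ : ∀ {w₁ w₂ w₃ w₂'} → C s w₁ w₂ w₃ ≡ + 0 →
          (+ s) ℤ.* (w₂ ℤ.+ w₂') ≡ (+ 2) ℤ.* w₁ ℤ.* w₃ →
          Move s (w₁ , w₂ , w₃) (w₁ , w₂' , w₃)
  move₃ : ∀ {w₁ w₂ w₃ w₃'} → C s w₁ w₂ w₃ ≡ + 0 →
          (+ s) ℤ.* (w₃ ℤ.+ w₃') ≡ (+ 2) ℤ.* w₁ ℤ.* w₂ →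
          Move s (w₁ , w₂ , w₃) (w₁ , w₂ , w₃')

Reduces : ℕ → Triple → Triple → Set
Reduces s = Star (Move s)

IsPermSBB : ℕ → ℕ → Triple → Set
IsPermSBB s b t = (t ≡ (+ s , + b , + b)) ⊎ (t ≡ (+ b , + s , + b)) ⊎ (t ≡ (+ b , + b , + s))

R : (s b : ℕ) .{{_ : NonZero s}} → ℕ → ℚ
R s b zero = + s ℚ./ 1
R s b (suc zero) = + b ℚ./ 1
R s b (suc (suc n)) = ((+ (2 ℕ.* b)) ℚ./ s) ℚ.* R s b (suc n) ℚ.- R s b n

_∈₃_ : ℚ → ℚ × ℚ × ℚ → Set
a ∈₃ (x , y , z) = (a ≡ x) ⊎ (a ≡ y) ⊎ (a ≡ z)

SetEq₃ : ℚ × ℚ × ℚ → ℚ × ℚ × ℚ → Set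
SetEq₃ (x₁ , x₂ , x₃) Y@(y₁ , y₂ , y₃) =
  (x₁ ∈₃ Y × x₂ ∈₃ Y × x₃ ∈₃ Y) ×
  (y₁ ∈₃ (x₁ , x₂ , x₃) × y₂ ∈₃ (x₁ , x₂ , x₃) × y₃ ∈₃ (x₁ , x₂ , x₃))

-- Since R_n = s T_n(b/s), the Chebyshev product formula 2 T_a T_c = T_(a+c) + T_|a−c| becomes
-- 2 R_a R_c = s (R_(a+c) + R_|a−c|).  Call (R_i, R_j, R_l) an R-triple when one of the indices
-- is the sum of the other two.  In an R-triple the two roots of C_s in the first coordinate are
-- R_(j+l) and R_|j−l|, and replacing one by the other again gives an R-triple.  The triple
-- (s, b, b) = (R_0, R_1, R_1) is an R-triple and moves are reversible, so every triple that
-- reduces to a permutation of it is an R-triple, i.e. of the form {R_n, R_(n+m), R_m}.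

module Submission where

open import Defs
open import Data.Nat as ℕ using (ℕ; zero; suc; NonZero; ∣_-_∣)
open import Data.Nat.Divisibility using (_∣_)
import Data.Nat.Properties as ℕ
open import Data.Integer as ℤ using (ℤ; +_)
import Data.Integer.Properties as ℤ
open import Data.Rational as ℚ using (ℚ; _+_; _*_; _-_; 1/_)
open import Data.Rational.Properties
  using (toℚᵘ-injective; toℚᵘ-fromℚᵘ; toℚᵘ-homo-+; toℚᵘ-homo-*; +-0-group; +-comm; *-assoc;
         *-identityˡ; *-inverseˡ; normalize-pos; pos⇒nonZero)
open import Data.Rational.Solver using (module +-*-Solver)
import Data.Rational.Unnormalised as ℚᵘ
import Data.Rational.Unnormalised.Properties as ℚᵘ
open import Algebra.Properties.Group +-0-group using (∙-cancelˡ)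
open import Data.Product using (Σ; ∃₂; _×_; _,_)
open import Data.Sum using (_⊎_; inj₁; inj₂)
open import Relation.Binary.PropositionalEquality
open import Relation.Binary.Construct.Closure.ReflexiveTransitive using (ε; _◅_)

open +-*-Solver

ι : ℤ → ℚ
ι z = z ℚ./ 1

toℚᵘ-ι : ∀ z → ℚ.toℚᵘ (ι z) ℚᵘ.≃ ℚᵘ.mkℚᵘ z 0
toℚᵘ-ι z = toℚᵘ-fromℚᵘ (ℚᵘ.mkℚᵘ z 0)

ι-+ : ∀ a b → ι (a ℤ.+ b) ≡ ι a + ι b
ι-+ a b = toℚᵘ-injective (begin
    ℚ.toℚᵘ (ι (a ℤ.+ b))                  ≈⟨ toℚᵘ-ι (a ℤ.+ b) ⟩
    ℚᵘ.mkℚᵘ (a ℤ.+ b) 0                   ≈⟨ ℚᵘ.*≡* (cong (ℤ._* + 1) (cong₂ ℤ._+_ (sym (ℤ.*-identityʳ a)) (sym (ℤ.*-identityʳ b)))) ⟩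
    ℚᵘ.mkℚᵘ a 0 ℚᵘ.+ ℚᵘ.mkℚᵘ b 0          ≈⟨ ℚᵘ.+-cong (toℚᵘ-ι a) (toℚᵘ-ι b) ⟨
    ℚ.toℚᵘ (ι a) ℚᵘ.+ ℚ.toℚᵘ (ι b)        ≈⟨ toℚᵘ-homo-+ (ι a) (ι b) ⟨
    ℚ.toℚᵘ (ι a + ι b)                    ∎)
  where open ℚᵘ.≃-Reasoning

ι-* : ∀ a b → ι (a ℤ.* b) ≡ ι a * ι b
ι-* a b = toℚᵘ-injective (begin
    ℚ.toℚᵘ (ι (a ℤ.* b))                  ≈⟨ toℚᵘ-ι (a ℤ.* b) ⟩
    ℚᵘ.mkℚᵘ a 0 ℚᵘ.* ℚᵘ.mkℚᵘ b 0          ≈⟨ ℚᵘ.*-cong (toℚᵘ-ι a) (toℚᵘ-ι b) ⟨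
    ℚ.toℚᵘ (ι a) ℚᵘ.* ℚ.toℚᵘ (ι b)        ≈⟨ toℚᵘ-homo-* (ι a) (ι b) ⟨
    ℚ.toℚᵘ (ι a * ι b)                    ∎)
  where open ℚᵘ.≃-Reasoning

ι-*-/ : ∀ s .{{_ : NonZero s}} z → ι (+ s) * (z ℚ./ s) ≡ ι z
ι-*-/ (suc s) z = toℚᵘ-injective (begin
    ℚ.toℚᵘ (ι (+ suc s) * (z ℚ./ suc s))                  ≈⟨ toℚᵘ-homo-* (ι (+ suc s)) (z ℚ./ suc s) ⟩
    ℚ.toℚᵘ (ι (+ suc s)) ℚᵘ.* ℚ.toℚᵘ (z ℚ./ suc s)        ≈⟨ ℚᵘ.*-cong (toℚᵘ-ι (+ suc s)) (toℚᵘ-fromℚᵘ (ℚᵘ.mkℚᵘ z s)) ⟩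
    ℚᵘ.mkℚᵘ (+ suc s) 0 ℚᵘ.* ℚᵘ.mkℚᵘ z s                  ≈⟨ ℚᵘ.*≡* (trans (ℤ.*-identityʳ _) (trans (ℤ.*-comm (+ suc s) z) (cong (λ n → z ℤ.* + n) (sym (ℕ.*-identityˡ (suc s)))))) ⟩
    ℚᵘ.mkℚᵘ z 0                                           ≈⟨ toℚᵘ-ι z ⟨
    ℚ.toℚᵘ (ι z)                                          ∎)
  where open ℚᵘ.≃-Reasoning

*-cancelˡ-nonZero : ∀ r .{{_ : ℚ.NonZero r}} {p q} → r * p ≡ r * q → p ≡ q
*-cancelˡ-nonZero r {p} {q} rp≡rq = begin
    p                ≡⟨ *-identityˡ p ⟨
    ℚ.1ℚ * p         ≡⟨ cong (_* p) (*-inverseˡ r) ⟨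
    (1/ r) * r * p   ≡⟨ *-assoc (1/ r) r p ⟩
    (1/ r) * (r * p) ≡⟨ cong ((1/ r) *_) rp≡rq ⟩
    (1/ r) * (r * q) ≡⟨ *-assoc (1/ r) r q ⟨
    (1/ r) * r * q   ≡⟨ cong (_* q) (*-inverseˡ r) ⟩
    ℚ.1ℚ * q         ≡⟨ *-identityˡ q ⟩
    q                ∎
  where open ≡-Reasoning

ι-nonZero : ∀ s .{{_ : NonZero s}} → ℚ.NonZero (ι (+ s))
ι-nonZero (suc s) = pos⇒nonZero (ι (+ suc s)) {{normalize-pos (suc s) 1}}

SumTriple : ℕ → ℕ → ℕ → Set
SumTriple a b c = a ≡ b ℕ.+ c ⊎ b ≡ a ℕ.+ c ⊎ c ≡ a ℕ.+ b

SumTriple-swap₁₂ : ∀ {a b c} → SumTriple a b c → SumTriple b a c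
SumTriple-swap₁₂ (inj₁ a≡b+c)                = inj₂ (inj₁ a≡b+c)
SumTriple-swap₁₂ (inj₂ (inj₁ b≡a+c))         = inj₁ b≡a+c
SumTriple-swap₁₂ {a} {b} (inj₂ (inj₂ c≡a+b)) = inj₂ (inj₂ (trans c≡a+b (ℕ.+-comm a b)))

SumTriple-swap₂₃ : ∀ {a b c} → SumTriple a b c → SumTriple a c b
SumTriple-swap₂₃ {a} {b} {c} (inj₁ a≡b+c) = inj₁ (trans a≡b+c (ℕ.+-comm b c))
SumTriple-swap₂₃ (inj₂ (inj₁ b≡a+c))      = inj₂ (inj₂ b≡a+c)
SumTriple-swap₂₃ (inj₂ (inj₂ c≡a+b))      = inj₂ (inj₁ c≡a+b)

SumTriple-∣-∣ : ∀ b c → SumTriple ∣ b - c ∣ b c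
SumTriple-∣-∣ b c with ℕ.≤-total b c
... | inj₁ b≤c = inj₂ (inj₂ (trans (sym (ℕ.m∸n+n≡m b≤c)) (cong (ℕ._+ b) (sym (ℕ.m≤n⇒∣m-n∣≡n∸m b≤c)))))
... | inj₂ c≤b = inj₂ (inj₁ (trans (sym (ℕ.m∸n+n≡m c≤b)) (cong (ℕ._+ c) (sym (ℕ.m≤n⇒∣n-m∣≡n∸m c≤b)))))

SumTriple-flip₁ : ∀ {a b c} → SumTriple a b c →
  Σ ℕ λ a' → SumTriple a' b c × ((a , a') ≡ (b ℕ.+ c , ∣ b - c ∣) ⊎ (a , a') ≡ (∣ b - c ∣ , b ℕ.+ c))
SumTriple-flip₁ {b = b} {c} (inj₁ refl) = ∣ b - c ∣ , SumTriple-∣-∣ b c , inj₁ refl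
SumTriple-flip₁ {a} {c = c} (inj₂ (inj₁ refl)) = a ℕ.+ c ℕ.+ c , inj₁ refl ,
  inj₂ (cong (_, a ℕ.+ c ℕ.+ c) (sym (begin
    ∣ a ℕ.+ c - c ∣       ≡⟨ ℕ.∣-∣-comm (a ℕ.+ c) c ⟩
    ∣ c - a ℕ.+ c ∣       ≡⟨ cong ∣ c -_∣ (ℕ.+-comm a c) ⟩
    ∣ c - c ℕ.+ a ∣       ≡⟨ ℕ.∣m-m+n∣≡n c a ⟩
    a                     ∎)))
  where open ≡-Reasoning
SumTriple-flip₁ {a} {b} (inj₂ (inj₂ refl)) = b ℕ.+ (a ℕ.+ b) , inj₁ refl ,
  inj₂ (cong (_, b ℕ.+ (a ℕ.+ b)) (sym (trans (cong ∣ b -_∣ (ℕ.+-comm a b)) (ℕ.∣m-m+n∣≡n b a))))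

SetEq₃-refl : ∀ {x y z} → SetEq₃ (x , y , z) (x , y , z)
SetEq₃-refl = (inj₁ refl , inj₂ (inj₁ refl) , inj₂ (inj₂ refl)) , (inj₁ refl , inj₂ (inj₁ refl) , inj₂ (inj₂ refl))

SetEq₃-swap₁₂ : ∀ {x y z} → SetEq₃ (x , y , z) (y , x , z)
SetEq₃-swap₁₂ = (inj₂ (inj₁ refl) , inj₁ refl , inj₂ (inj₂ refl)) , (inj₂ (inj₁ refl) , inj₁ refl , inj₂ (inj₂ refl))

SetEq₃-swap₂₃ : ∀ {x y z} → SetEq₃ (x , y , z) (x , z , y)
SetEq₃-swap₂₃ = (inj₁ refl , inj₂ (inj₂ refl) , inj₂ (inj₁ refl)) , (inj₁ refl , inj₂ (inj₂ refl) , inj₂ (inj₁ refl))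

module _ (s b : ℕ) .{{_ : NonZero s}} where

  private
    S k : ℚ
    S = ι (+ s)
    k = + (2 ℕ.* b) ℚ./ s

  two-R₁≡S*k : ι (+ 2) * R s b 1 ≡ S * k
  two-R₁≡S*k = begin
    ι (+ 2) * ι (+ b)    ≡⟨ ι-* (+ 2) (+ b) ⟨
    ι (+ 2 ℤ.* + b)      ≡⟨ cong ι (ℤ.pos-* 2 b) ⟨
    ι (+ (2 ℕ.* b))      ≡⟨ ι-*-/ s (+ (2 ℕ.* b)) ⟨
    S * k                ∎
    where open ≡-Reasoning

  ProductFormula : ℕ → ℕ → ℕ → Set
  ProductFormula m n j = ι (+ 2) * R s b m * R s b j ≡ S * (R s b n + R s b (m ℕ.+ j))

  ProductFormula-step : ∀ m n → ProductFormula (suc m) (suc n) (2 ℕ.+ (m ℕ.+ n)) →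
                        ProductFormula m (2 ℕ.+ n) (2 ℕ.+ (m ℕ.+ n)) →
                        ProductFormula (2 ℕ.+ m) n (2 ℕ.+ (m ℕ.+ n))
  ProductFormula-step m n ih₁ ih₂ = begin
    ι (+ 2) * (k * Rm₁ - Rm) * P                                ≡⟨ solve 5 (λ i k A B P → i :* (k :* A :- B) :* P := k :* (i :* A :* P) :- i :* B :* P) refl (ι (+ 2)) k Rm₁ Rm P ⟩
    k * (ι (+ 2) * Rm₁ * P) - ι (+ 2) * Rm * P                  ≡⟨ cong₂ _-_ (cong (k *_) ih₁) ih₂ ⟩
    k * (S * (R s b (suc n) + X)) - S * (R s b (2 ℕ.+ n) + Y)  ≡⟨ solve 6 (λ k S Rn₁ Rn X Y → k :* (S :* (Rn₁ :+ X)) :- S :* ((k :* Rn₁ :- Rn) :+ Y) := S :* (Rn :+ (k :* X :- Y))) refl k S (R s b (suc n)) (R s b n) X Y ⟩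
    S * (R s b n + (k * X - Y))                                 ∎
    where
    open ≡-Reasoning
    Rm₁ Rm P X Y : ℚ
    Rm₁ = R s b (suc m)
    Rm = R s b m
    P = R s b (2 ℕ.+ (m ℕ.+ n))
    X = R s b (suc (m ℕ.+ (2 ℕ.+ (m ℕ.+ n))))
    Y = R s b (m ℕ.+ (2 ℕ.+ (m ℕ.+ n)))

  R-product : ∀ m n → ProductFormula m n (m ℕ.+ n)
  R-product zero n =
    solve 2 (λ S x → (con ℚ.1ℚ :+ con ℚ.1ℚ) :* S :* x := S :* (x :+ x)) refl S (R s b n)
  R-product (suc zero) n = begin
    ι (+ 2) * R s b 1 * R s b (suc n)     ≡⟨ cong (_* R s b (suc n)) two-R₁≡S*k ⟩
    S * k * R s b (suc n)                 ≡⟨ solve 4 (λ S k x y → S :* k :* x := S :* (y :+ (k :* x :- y))) refl S k (R s b (suc n)) (R s b n) ⟩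
    S * (R s b n + R s b (2 ℕ.+ n))       ∎
    where open ≡-Reasoning
  R-product (suc (suc m)) n = ProductFormula-step m n
    (subst (ProductFormula (suc m) (suc n)) (cong suc (ℕ.+-suc m n)) (R-product (suc m) (suc n)))
    (subst (ProductFormula m (2 ℕ.+ n)) (trans (ℕ.+-suc m (suc n)) (cong suc (ℕ.+-suc m n))) (R-product m (2 ℕ.+ n)))

  R-product-≤ : ∀ {a c} → a ℕ.≤ c → ι (+ 2) * R s b a * R s b c ≡ S * (R s b (a ℕ.+ c) + R s b ∣ a - c ∣)
  R-product-≤ {a} a≤c with ℕ.m≤n⇒∃[o]m+o≡n a≤c
  ... | n , refl rewrite ℕ.∣m-m+n∣≡n a n = trans (R-product a n) (cong (S *_) (+-comm (R s b n) _))

  R-product-∣-∣ : ∀ a c → ι (+ 2) * R s b a * R s b c ≡ S * (R s b (a ℕ.+ c) + R s b ∣ a - c ∣)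
  R-product-∣-∣ a c with ℕ.≤-total a c
  ... | inj₁ a≤c = R-product-≤ a≤c
  ... | inj₂ c≤a = begin
    ι (+ 2) * R s b a * R s b c                ≡⟨ solve 3 (λ i x y → i :* x :* y := i :* y :* x) refl (ι (+ 2)) (R s b a) (R s b c) ⟩
    ι (+ 2) * R s b c * R s b a                ≡⟨ R-product-≤ c≤a ⟩
    S * (R s b (c ℕ.+ a) + R s b ∣ c - a ∣)    ≡⟨ cong₂ (λ i j → S * (R s b i + R s b j)) (ℕ.+-comm c a) (ℕ.∣-∣-comm c a) ⟩
    S * (R s b (a ℕ.+ c) + R s b ∣ a - c ∣)    ∎
    where open ≡-Reasoning

  data IsRTriple : ℚ → ℚ → ℚ → Set where
    R-triple : ∀ {i j l} → SumTriple i j l → IsRTriple (R s b i) (R s b j) (R s b l)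

  IsRTriple-swap₁₂ : ∀ {x y z} → IsRTriple x y z → IsRTriple y x z
  IsRTriple-swap₁₂ (R-triple t) = R-triple (SumTriple-swap₁₂ t)

  IsRTriple-swap₂₃ : ∀ {x y z} → IsRTriple x y z → IsRTriple x z y
  IsRTriple-swap₂₃ (R-triple t) = R-triple (SumTriple-swap₂₃ t)

  IsRTriple-jump₁ : ∀ {x y z x'} → IsRTriple x y z → S * (x + x') ≡ ι (+ 2) * y * z → IsRTriple x' y z
  IsRTriple-jump₁ {x' = x'} (R-triple {i} {j} {l} t) vieta with SumTriple-flip₁ t
  ... | i' , t' , roots = subst (λ x' → IsRTriple x' (R s b j) (R s b l)) (sym x'≡Ri') (R-triple t')
    where
    roots-sum : ∀ {a a'} → (a , a') ≡ (j ℕ.+ l , ∣ j - l ∣) ⊎ (a , a') ≡ (∣ j - l ∣ , j ℕ.+ l) →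
                R s b (j ℕ.+ l) + R s b ∣ j - l ∣ ≡ R s b a + R s b a'
    roots-sum (inj₁ refl) = refl
    roots-sum (inj₂ refl) = +-comm (R s b (j ℕ.+ l)) (R s b ∣ j - l ∣)
    x'≡Ri' : x' ≡ R s b i'
    x'≡Ri' = ∙-cancelˡ (R s b i) x' (R s b i') (*-cancelˡ-nonZero S {{ι-nonZero s}}
               (trans vieta (trans (R-product-∣-∣ j l) (cong (S *_) (roots-sum roots)))))

  ι-vieta : ∀ w w' y z → + s ℤ.* (w ℤ.+ w') ≡ + 2 ℤ.* y ℤ.* z → S * (ι w' + ι w) ≡ ι (+ 2) * ι y * ι z
  ι-vieta w w' y z e = begin
    S * (ι w' + ι w)          ≡⟨ cong (S *_) (+-comm (ι w') (ι w)) ⟩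
    S * (ι w + ι w')          ≡⟨ cong (S *_) (ι-+ w w') ⟨
    S * ι (w ℤ.+ w')          ≡⟨ ι-* (+ s) (w ℤ.+ w') ⟨
    ι (+ s ℤ.* (w ℤ.+ w'))    ≡⟨ cong ι e ⟩
    ι (+ 2 ℤ.* y ℤ.* z)       ≡⟨ ι-* (+ 2 ℤ.* y) z ⟩
    ι (+ 2 ℤ.* y) * ι z       ≡⟨ cong (_* ι z) (ι-* (+ 2) y) ⟩
    ι (+ 2) * ι y * ι z       ∎
    where open ≡-Reasoning

  IsRTripleℤ : Triple → Set
  IsRTripleℤ (u , v , w) = IsRTriple (ι u) (ι v) (ι w)

  -- The relation s (w + w') = 2 y z defining a move is symmetric in w and w', so a move read backwards is again a jump.
  IsRTripleℤ-backward : ∀ {u w} → Move s u w → IsRTripleℤ w → IsRTripleℤ u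
  IsRTripleℤ-backward (move₁ {w₁} {w₂} {w₃} {w₁'} _ e) t = IsRTriple-jump₁ t (ι-vieta w₁ w₁' w₂ w₃ e)
  IsRTripleℤ-backward (move₂ {w₁} {w₂} {w₃} {w₂'} _ e) t =
    IsRTriple-swap₁₂ (IsRTriple-jump₁ (IsRTriple-swap₁₂ t) (ι-vieta w₂ w₂' w₁ w₃ e))
  IsRTripleℤ-backward (move₃ {w₁} {w₂} {w₃} {w₃'} _ e) t =
    IsRTriple-swap₂₃ (IsRTriple-swap₁₂ (IsRTriple-jump₁ (IsRTriple-swap₁₂ (IsRTriple-swap₂₃ t)) (ι-vieta w₃ w₃' w₁ w₂ e)))

  IsRTripleℤ-reduces : ∀ {u w} → Reduces s u w → IsRTripleℤ w → IsRTripleℤ u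
  IsRTripleℤ-reduces ε         t = t
  IsRTripleℤ-reduces (m ◅ u↝w) t = IsRTripleℤ-backward m (IsRTripleℤ-reduces u↝w t)

  IsPermSBB⇒IsRTripleℤ : ∀ {t} → IsPermSBB s b t → IsRTripleℤ t
  IsPermSBB⇒IsRTripleℤ (inj₁ refl)        = R-triple {0} {1} {1} (inj₂ (inj₁ refl))
  IsPermSBB⇒IsRTripleℤ (inj₂ (inj₁ refl)) = R-triple {1} {0} {1} (inj₁ refl)
  IsPermSBB⇒IsRTripleℤ (inj₂ (inj₂ refl)) = R-triple {1} {1} {0} (inj₁ refl)

  IsRTriple⇒SetEq₃ : ∀ {x y z} → IsRTriple x y z → ∃₂ λ n m → SetEq₃ (x , y , z) (R s b n , R s b (n ℕ.+ m) , R s b m)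
  IsRTriple⇒SetEq₃ (R-triple {j = j} {l} (inj₁ refl))        = j , l , SetEq₃-swap₁₂
  IsRTriple⇒SetEq₃ (R-triple {i} {l = l} (inj₂ (inj₁ refl))) = i , l , SetEq₃-refl
  IsRTriple⇒SetEq₃ (R-triple {i} {j} (inj₂ (inj₂ refl)))     = i , j , SetEq₃-swap₂₃

mainTheorem8 : (s b v₁ v₂ v₃ : ℕ) .{{_ : NonZero s}} → b ℕ.> 0 →
    v₁ ℕ.> 0 → v₂ ℕ.> 0 → v₃ ℕ.> 0 →
    C s (+ v₁) (+ v₂) (+ v₃) ≡ + 0 →
    (Σ Triple λ t → Reduces s (+ v₁ , + v₂ , + v₃) t × IsPermSBB s b t) →
    s ∣ 2 ℕ.* b →
    ∃₂ λ n m → SetEq₃ (+ v₁ ℚ./ 1 , + v₂ ℚ./ 1 , + v₃ ℚ./ 1)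
    (R s b n , R s b (n ℕ.+ m) , R s b m)
mainTheorem8 s b v₁ v₂ v₃ _ _ _ _ _ (t , v↝t , t≈sbb) _ =
  IsRTriple⇒SetEq₃ s b (IsRTripleℤ-reduces s b v↝t (IsPermSBB⇒IsRTripleℤ s b t≈sbb))
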